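{- Consider a run of the simplex method with the highest-gain pivoting rule on a deterministic MDP with $n$ states and uniform discount $\gamma\in[0,1)$. Suppose the method pivots from policy $\pi$ to policy $\pi'$ and $\pi'$ does not create a new cycle. Let $\pi''$ be the last policy of the run whose cycles are all cycles of $\pi$ (i.e., the last policy before the next pivot that creates a new cycle, or the final policy if no such pivot occurs). Then $$r^T(x^{\pi''}-x^{\pi'}) \le \left(1-\frac{1}{n^2}\right) r^T(x^{\pi''}-x^{\pi}).$$
   Context: A deterministic MDP has $n$ states $S$ and a finite set of actions $A$; action $a$ is performable in state $s(a)$, has reward $r_a\in\mathbb{R}$, leads deterministically to state $t(a)$, and all actions have discount $\gamma\in[0,1)$; each state has at least one action. A policy $\pi$ picks one action $\pi(s)$ with $s(\pi(s))=s$ per state. Values: $v^\pi$ is the unique solution of $v^\pi_s=r_{\pi(s)}+\gamma v^\pi_{t(\pi(s))}$. Gains: $r^\pi_a=r_a+\gamma v^\pi_{t(a)}-v^\pi_{s(a)}$. Flux: $x^\pi_a=0$ if $a\notin\pi$ and $x^\pi_{\pi(s)}=y_s$ where $y$ solves $y_s=1+\gamma\sum_{s':t(\pi(s'))=s}y_{s'}$. We write $r^T x=\sum_a r_a x_a$. The functional graph of $\pi$ has edges $s\to t(\pi(s))$; its directed cycles (identified with their sets of actions) are the cycles of $\pi$; actions of $\pi$ not on a cycle are on paths. The simplex method with highest-gain pivoting: start from any policy; while some gain is positive, choose $a$ maximizing $r^\pi_a$ and replace $\pi(s(a))$ by $a$; stop when all gains are $\le0$. A pivot from $\pi$ to $\pi'$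 creates a new cycle if $\pi'$ has a cycle that is not a cycle of $\pi$.
   Formalization: The rewards $r_a$ and the discount γ are rational numbers rather than real ones. -}

module Defs where

open import Data.Nat as ℕ using (ℕ; zero; suc; NonZero)
import Data.Nat.Properties as ℕP
open import Data.Fin using (Fin; zero; suc; _≟_)
open import Data.Integer using (+_)
open import Data.Rational using (ℚ; 0ℚ; 1ℚ; _+_; _*_; _-_; _≤_; _<_; _/_)
open import Data.Bool using (if_then_else_)
open import Data.Product using (Σ; ∃; _×_; _,_)
open import Relation.Nullary using (¬_)
open import Relation.Nullary.Decidable using (⌊_⌋)
open import Relation.Binary.PropositionalEquality using (_≡_)
open import Function.Bundles using (_⇔_)

∑ : (k : ℕ) → (Fin k → ℚ) → ℚ
∑ zero    f = 0ℚ
∑ (suc k) f = f zero + ∑ k (λ i → f (suc i))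

record DMDP (n m : ℕ) : Set where
  field
    src   : Fin m → Fin n
    tgt   : Fin m → Fin n
    rew   : Fin m → ℚ
    γ     : ℚ
    0≤γ   : 0ℚ ≤ γ
    γ<1   : γ < 1ℚ
    total : ∀ s → ∃ λ a → src a ≡ s

module _ {n m : ℕ} (M : DMDP n m) where
  open DMDP M

  record Policy : Set where
    field
      act : Fin n → Fin m
      ok  : ∀ s → src (act s) ≡ s
  open Policy public

  -- v is the value vector of π:  v_s = r_{π(s)} + γ v_{t(π(s))}
  -- (the solution is unique since γ < 1).
  IsValue : Policy → (Fin n → ℚ) → Set
  IsValue π v = ∀ s → v s ≡ rew (act π s) + γ * v (tgt (act π s))

  gain : (Fin n → ℚ) → Fin m → ℚ
  gain v a = rew a + γ * v (tgt a) - v (src a)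

  -- y solves  y_s = 1 + γ Σ_{s' : t(π(s')) = s} y_{s'}  (unique since γ < 1)
  IsFluxVec : Policy → (Fin n → ℚ) → Set
  IsFluxVec π y = ∀ s →
    y s ≡ 1ℚ + γ * ∑ n (λ s' → if ⌊ tgt (act π s') ≟ s ⌋ then y s' else 0ℚ)

  flux : Policy → (Fin n → ℚ) → Fin m → ℚ
  flux π y a = if ⌊ act π (src a) ≟ a ⌋ then y (src a) else 0ℚ

  rTx : Policy → (Fin n → ℚ) → ℚ
  rTx π y = ∑ m (λ a → rew a * flux π y a)

  HGPivot : Policy → Policy → Set
  HGPivot π π' = Σ (Fin n → ℚ) λ v → IsValue π v × Σ (Fin m) λ a →
      (0ℚ < gain v a)
    × (∀ b → gain v b ≤ gain v a)
    × (∀ s → act π' s ≡ (if ⌊ s ≟ src a ⌋ then a else act π s))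

  Terminal : Policy → Set
  Terminal π = Σ (Fin n → ℚ) λ v → IsValue π v × (∀ a → gain v a ≤ 0ℚ)

  next : Policy → Fin n → Fin n
  next π s = tgt (act π s)

  iter : Policy → ℕ → Fin n → Fin n
  iter π zero    s = s
  iter π (suc k) s = next π (iter π k s)

  OnCycle : Policy → Fin n → Set
  OnCycle π s = Σ ℕ λ k → (0 ℕ.< k) × (iter π k s ≡ s)

  -- the set of actions of the cycle of π through s (s on a cycle)
  CycleAct : Policy → Fin n → Fin m → Set
  CycleAct π s a = Σ ℕ λ i → a ≡ act π (iter π i s)

  IsCycleOf : Policy → Policy → Fin n → Set
  IsCycleOf π π' s' = Σ (Fin n) λ s → OnCycle π s ×
    (∀ a → CycleAct π' s' a ⇔ CycleAct π s a)

  CreatesNewCycle : Policy → Policy → Set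
  CreatesNewCycle π π' = Σ (Fin n) λ s' → OnCycle π' s' × ¬ IsCycleOf π π' s'

  record Run : Set where
    field
      pol  : ℕ → Policy
      len  : ℕ
      step : ∀ k → k ℕ.< len → HGPivot (pol k) (pol (suc k))
      term : Terminal (pol len)
  open Run public

factor : (n : ℕ) → .{{NonZero n}} → ℚ
factor n = 1ℚ - (+ 1 / (n ℕ.* n)) {{ℕP.m*n≢0 n n}}

module Submission where

-- Fix the value vector v of π. For every policy σ with flux y one has
-- r·x^σ = Σ_s v_s + Σ_s gain_v(σ(s)) · y_s, so r·x^π = Σ v, the pivot on the
-- highest-gain action a gives r·x^π′ = Σ v + Δ · y′_{s(a)} ≥ Σ v + Δ (fluxes are ≥ 1),
-- and every state contributes at most Δ · y″_s to r·x^π″. A state on a cycle of π″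
-- contributes nothing: no pivot between π and π″ creates a cycle, so the actions on
-- the cycles of π″ are actions of π, whose gains vanish. The remaining states carry
-- total flux at most n²: their distance to a cycle, at most n, is a potential h with
-- h_s = 1 + h_{t(π″(s))} off the cycles, and the flux equations turn this into
-- Σ_{s off cycle} y″_s ≤ Σ_s h_s.
-- Hence r·(x^π″ − x^π) ≤ n² Δ ≤ n² r·(x^π′ − x^π), which rearranges to the claim.

open import Defs

module RationalArithmetic where

  open import Data.Nat as ℕ using (ℕ; zero; suc)
  open import Data.Integer using () renaming (+_ to ℤ+)
  import Data.Integer.Solver as ℤ-Solver
  import Data.Nat.Coprimality as Coprime
  open import Data.Rational
  open import Data.Rational.Properties
  import Data.Rational.Solver as ℚ-Solver
  import Data.Rational.Unnormalised as ℚᵘ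
  import Data.Rational.Unnormalised.Properties as ℚᵘP
  open import Relation.Binary.PropositionalEquality
  open import Relation.Nullary using (yes; no)
  open import Relation.Nullary.Negation using (contradiction)
  open import Algebra.Definitions.RawMonoid +-0-rawMonoid public using () renaming (_×_ to _·_)

  ≤-from-gap : ∀ {p q r} → 0ℚ ≤ r → q ≡ p + r → p ≤ q
  ≤-from-gap {p} 0≤r refl = ≤-trans (≤-reflexive (sym (+-identityʳ p))) (+-monoʳ-≤ p 0≤r)

  0≤p-q : ∀ {p q} → q ≤ p → 0ℚ ≤ p - q
  0≤p-q {p} {q} q≤p = ≤-trans (≤-reflexive (sym (+-inverseʳ q))) (+-monoˡ-≤ (- q) q≤p)

  0≤p*q : ∀ {p q} → 0ℚ ≤ p → 0ℚ ≤ q → 0ℚ ≤ p * q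
  0≤p*q {p} {q} 0≤p 0≤q =
    nonNegative⁻¹ _ {{nonNeg*nonNeg⇒nonNeg p {{nonNegative 0≤p}} q {{nonNegative 0≤q}}}}

  ≤-contraction⇒≤0 : ∀ {c p} → c < 1ℚ → p ≤ c * p → p ≤ 0ℚ
  ≤-contraction⇒≤0 {c} {p} c<1 p≤cp with p ≤? 0ℚ
  ... | yes p≤0 = p≤0
  ... | no p≰0  = contradiction (≤-<-trans p≤cp cp<p) (<-irrefl refl)
    where
    cp<p : c * p < p
    cp<p = <-≤-trans (*-monoˡ-<-pos p {{positive (≰⇒> p≰0)}} c<1) (≤-reflexive (*-identityˡ p))

  gap-contraction : ∀ {c x y z} → c * (z - x) ≤ y - x → z - y ≤ (1ℚ - c) * (z - x)
  gap-contraction {c} {x} {y} {z} progress = ≤-from-gap (0≤p-q progress)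
    (solve 4 (λ c x y z → (con 1ℚ :- c) :* (z :- x) := (z :- y) :+ ((y :- x) :- c :* (z :- x)))
           refl c x y z)
    where open ℚ-Solver.+-*-Solver

  fromℕ : ℕ → ℚ
  fromℕ k = mkℚ (ℤ+ k) 0 (Coprime.sym (Coprime.1-coprimeTo k))

  ·1ℚ≡fromℕ : ∀ k → k · 1ℚ ≡ fromℕ k
  ·1ℚ≡fromℕ zero    = refl
  ·1ℚ≡fromℕ (suc k) = trans (cong (1ℚ +_) (·1ℚ≡fromℕ k))
    (toℚᵘ-injective (ℚᵘP.≃-trans (toℚᵘ-homo-+ 1ℚ (fromℕ k)) (ℚᵘ.*≡*
      (solve 1 (λ x → (con (ℤ+ 1) :* con (ℤ+ 1) :+ x :* con (ℤ+ 1)) :* con (ℤ+ 1)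
                       := (con (ℤ+ 1) :+ x) :* (con (ℤ+ 1) :* con (ℤ+ 1))) refl (ℤ+ k)))))
    where open ℤ-Solver.+-*-Solver

  1/suc≡1/fromℕ : ∀ k → ℤ+ 1 / suc k ≡ 1/ fromℕ (suc k)
  1/suc≡1/fromℕ k = normalize-coprime (Coprime.1-coprimeTo (suc k))

  0≤1/k : ∀ k .{{_ : ℕ.NonZero k}} → 0ℚ ≤ ℤ+ 1 / k
  0≤1/k (suc k) = subst (0ℚ ≤_) (sym (1/suc≡1/fromℕ k)) (nonNegative⁻¹ _)

  1/k*k·1ℚ≡1 : ∀ k .{{_ : ℕ.NonZero k}} → (ℤ+ 1 / k) * (k · 1ℚ) ≡ 1ℚ
  1/k*k·1ℚ≡1 (suc k) =
    trans (cong₂ _*_ (1/suc≡1/fromℕ k) (·1ℚ≡fromℕ (suc k))) (*-inverseˡ (fromℕ (suc k)))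

module FiniteSum where

  open import Data.Nat using (ℕ; zero; suc)
  open import Data.Fin using (Fin; zero; suc; toℕ; _≟_)
  open import Data.Fin.Properties using (punchInᵢ≢i)
  open import Data.Bool using (true; false; if_then_else_)
  open import Data.Rational using (ℚ; 0ℚ; _+_; _*_; _≤_)
  open import Data.Rational.Properties hiding (_≟_)
  open import Data.Vec.Functional using (removeAt)
  open import Algebra.Bundles using (Ring)
  open import Algebra.Properties.Semiring.Sum (Ring.semiring +-*-ring)
    using (sum; sum-remove; ∑-distrib-+; *-distribˡ-sum)
  open import Function using (_∘_)
  open import Relation.Binary.PropositionalEquality
  open import Relation.Nullary.Decidable using (⌊_⌋; isYes≗does; dec-true; dec-false)
  open RationalArithmetic using (_·_; ≤-from-gap)

  ∑≡sum : ∀ k (f : Fin k → ℚ) → ∑ k f ≡ sum f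
  ∑≡sum zero    f = refl
  ∑≡sum (suc k) f = cong (f zero +_) (∑≡sum k (f ∘ suc))

  ∑-cong : ∀ k {f g : Fin k → ℚ} → (∀ i → f i ≡ g i) → ∑ k f ≡ ∑ k g
  ∑-cong zero    f≗g = refl
  ∑-cong (suc k) f≗g = cong₂ _+_ (f≗g zero) (∑-cong k (f≗g ∘ suc))

  ∑-const : ∀ k p → ∑ k (λ _ → p) ≡ k · p
  ∑-const zero    p = refl
  ∑-const (suc k) p = cong (p +_) (∑-const k p)

  ∑-zero : ∀ k → ∑ k (λ _ → 0ℚ) ≡ 0ℚ
  ∑-zero zero    = refl
  ∑-zero (suc k) = trans (+-identityˡ _) (∑-zero k)

  ∑-+ : ∀ k (f g : Fin k → ℚ) → ∑ k (λ i → f i + g i) ≡ ∑ k f + ∑ k g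
  ∑-+ k f g = trans (∑≡sum k _)
    (trans (∑-distrib-+ f g) (sym (cong₂ _+_ (∑≡sum k f) (∑≡sum k g))))

  *-distribˡ-∑ : ∀ k p (f : Fin k → ℚ) → p * ∑ k f ≡ ∑ k (λ i → p * f i)
  *-distribˡ-∑ k p f = trans (cong (p *_) (∑≡sum k f))
    (trans (*-distribˡ-sum p f) (sym (∑≡sum k _)))

  ∑-comm : ∀ k l (f : Fin k → Fin l → ℚ) →
           ∑ k (λ i → ∑ l (f i)) ≡ ∑ l (λ j → ∑ k (λ i → f i j))
  ∑-comm zero    l f = sym (∑-zero l)
  ∑-comm (suc k) l f =
    trans (cong (∑ l (f zero) +_) (∑-comm k l (f ∘ suc))) (sym (∑-+ l (f zero) _))

  ∑-shift : ∀ k (g : ℕ → ℚ) → ∑ k (g ∘ toℕ) + g k ≡ g 0 + ∑ k (g ∘ suc ∘ toℕ)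
  ∑-shift zero    g = trans (+-identityˡ (g 0)) (sym (+-identityʳ (g 0)))
  ∑-shift (suc k) g =
    trans (+-assoc (g 0) _ (g (suc k))) (cong (g 0 +_) (∑-shift k (g ∘ suc)))

  ∑-remove : ∀ {k} (f : Fin (suc k) → ℚ) t → ∑ (suc k) f ≡ f t + ∑ k (removeAt f t)
  ∑-remove {k} f t = trans (∑≡sum (suc k) f)
    (trans (sum-remove {i = t} f) (cong (f t +_) (sym (∑≡sum k _))))

  ∑-supported : ∀ {k} (f : Fin k → ℚ) t → (∀ s → s ≢ t → f s ≡ 0ℚ) → ∑ k f ≡ f t
  ∑-supported {suc k} f t off = begin
    ∑ (suc k) f               ≡⟨ ∑-remove f t ⟩
    f t + ∑ k (removeAt f t)  ≡⟨ cong (f t +_) (∑-cong k (λ s → off _ (punchInᵢ≢i t s))) ⟩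
    f t + ∑ k (λ _ → 0ℚ)      ≡⟨ cong (f t +_) (∑-zero k) ⟩
    f t + 0ℚ                  ≡⟨ +-identityʳ (f t) ⟩
    f t                       ∎
    where open ≡-Reasoning

  ∑-mono : ∀ k {f g : Fin k → ℚ} → (∀ i → f i ≤ g i) → ∑ k f ≤ ∑ k g
  ∑-mono zero    f≤g = ≤-refl
  ∑-mono (suc k) f≤g = +-mono-≤ (f≤g zero) (∑-mono k (f≤g ∘ suc))

  ∑-nonneg : ∀ k {f : Fin k → ℚ} → (∀ i → 0ℚ ≤ f i) → 0ℚ ≤ ∑ k f
  ∑-nonneg k 0≤f = ≤-trans (≤-reflexive (sym (∑-zero k))) (∑-mono k 0≤f)

  term≤∑ : ∀ {k} {f : Fin k → ℚ} → (∀ i → 0ℚ ≤ f i) → ∀ t → f t ≤ ∑ k f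
  term≤∑ {suc k} {f} 0≤f t = ≤-from-gap (∑-nonneg k (λ s → 0≤f _)) (∑-remove f t)

  if-+ : ∀ b (p q : ℚ) →
         (if b then p else 0ℚ) + (if b then q else 0ℚ) ≡ (if b then p + q else 0ℚ)
  if-+ true  p q = refl
  if-+ false p q = +-identityˡ 0ℚ

  *-if : ∀ b (p q : ℚ) → p * (if b then q else 0ℚ) ≡ (if b then p * q else 0ℚ)
  *-if true  p q = refl
  *-if false p q = *-zeroʳ p

  if-nonneg : ∀ b {p : ℚ} → 0ℚ ≤ p → 0ℚ ≤ (if b then p else 0ℚ)
  if-nonneg true  0≤p = 0≤p
  if-nonneg false 0≤p = ≤-refl

  if-≟-refl : ∀ {k} {A : Set} (t : Fin k) {x y : A} → (if ⌊ t ≟ t ⌋ then x else y) ≡ x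
  if-≟-refl t {x} {y} =
    cong (if_then x else y) (trans (isYes≗does (t ≟ t)) (dec-true (t ≟ t) refl))

  if-≟-≢ : ∀ {k} {A : Set} {s t : Fin k} {x y : A} → s ≢ t → (if ⌊ s ≟ t ⌋ then x else y) ≡ y
  if-≟-≢ {s = s} {t} {x} {y} s≢t =
    cong (if_then x else y) (trans (isYes≗does (s ≟ t)) (dec-false (s ≟ t) s≢t))

  ∑-select : ∀ {k} (t : Fin k) (g : Fin k → ℚ) →
             ∑ k (λ s → if ⌊ t ≟ s ⌋ then g s else 0ℚ) ≡ g t
  ∑-select t g = trans (∑-supported _ t (λ s s≢t → if-≟-≢ (s≢t ∘ sym))) (if-≟-refl t)

module Flux {n m} (M : DMDP n m) where

  open import Data.Fin using (Fin; _≟_)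
  open import Data.Bool using (if_then_else_)
  open import Data.Rational using (ℚ; 0ℚ; 1ℚ; _+_; _*_; _-_; -_; _≤_; _⊔_)
  open import Data.Rational.Properties hiding (_≟_)
  open import Data.Rational.Solver using (module +-*-Solver)
  open import Relation.Binary.PropositionalEquality
  open import Relation.Nullary using (yes; no)
  open import Relation.Nullary.Decidable using (⌊_⌋)
  open import Relation.Nullary.Negation using (contradiction)
  open DMDP M
  open FiniteSum
  open RationalArithmetic using (≤-from-gap; 0≤p-q; 0≤p*q; ≤-contraction⇒≤0)
  open +-*-Solver

  inflow : Policy M → (Fin n → ℚ) → Fin n → ℚ
  inflow σ y s = ∑ n (λ s′ → if ⌊ next M σ s′ ≟ s ⌋ then y s′ else 0ℚ)

  ∑-*-inflow : ∀ σ (F y : Fin n → ℚ) →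
               ∑ n (λ s → F s * inflow σ y s) ≡ ∑ n (λ s′ → y s′ * F (next M σ s′))
  ∑-*-inflow σ F y = begin
    ∑ n (λ s → F s * inflow σ y s)
      ≡⟨ ∑-cong n (λ s → trans (*-distribˡ-∑ n (F s) _) (∑-cong n (λ s′ → *-if _ (F s) (y s′)))) ⟩
    ∑ n (λ s → ∑ n (λ s′ → if ⌊ next M σ s′ ≟ s ⌋ then F s * y s′ else 0ℚ))
      ≡⟨ ∑-comm n n _ ⟩
    ∑ n (λ s′ → ∑ n (λ s → if ⌊ next M σ s′ ≟ s ⌋ then F s * y s′ else 0ℚ))
      ≡⟨ ∑-cong n (λ s′ → trans (∑-select (next M σ s′) (λ s → F s * y s′)) (*-comm _ (y s′))) ⟩
    ∑ n (λ s′ → y s′ * F (next M σ s′)) ∎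
    where open ≡-Reasoning

  ∑-inflow : ∀ σ (y : Fin n → ℚ) → ∑ n (inflow σ y) ≡ ∑ n y
  ∑-inflow σ y = trans (∑-comm n n _) (∑-cong n (λ s′ → ∑-select (next M σ s′) (λ _ → y s′)))

  inflow-+ : ∀ σ (y z : Fin n → ℚ) s →
             inflow σ (λ s′ → y s′ + z s′) s ≡ inflow σ y s + inflow σ z s
  inflow-+ σ y z s = trans (∑-cong n (λ s′ → sym (if-+ _ (y s′) (z s′)))) (∑-+ n _ _)

  inflow-nonneg : ∀ σ {y : Fin n → ℚ} → (∀ s → 0ℚ ≤ y s) → ∀ s → 0ℚ ≤ inflow σ y s
  inflow-nonneg σ 0≤y s = ∑-nonneg n (λ s′ → if-nonneg _ (0≤y s′))

  flux-balance : ∀ σ {y} → IsFluxVec M σ y → ∀ (F : Fin n → ℚ) →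
                 ∑ n (λ s → F s * y s) ≡ ∑ n F + γ * ∑ n (λ s → y s * F (next M σ s))
  flux-balance σ {y} flux F = begin
    ∑ n (λ s → F s * y s)
      ≡⟨ ∑-cong n (λ s → trans (cong (F s *_) (flux s)) (distribute (F s) (inflow σ y s))) ⟩
    ∑ n (λ s → F s + γ * (F s * inflow σ y s))
      ≡⟨ ∑-+ n _ _ ⟩
    ∑ n F + ∑ n (λ s → γ * (F s * inflow σ y s))
      ≡⟨ cong (∑ n F +_) (*-distribˡ-∑ n γ _) ⟨
    ∑ n F + γ * ∑ n (λ s → F s * inflow σ y s)
      ≡⟨ cong (λ x → ∑ n F + γ * x) (∑-*-inflow σ F y) ⟩
    ∑ n F + γ * ∑ n (λ s → y s * F (next M σ s)) ∎
    where
    open ≡-Reasoning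
    distribute : ∀ p q → p * (1ℚ + γ * q) ≡ p + γ * (p * q)
    distribute p q = solve 3 (λ p g q → p :* (con 1ℚ :+ g :* q) := p :+ g :* (p :* q)) refl p γ q

  -- u = max(0, −y) satisfies u ≤ γ · inflow u, and inflow preserves the total mass,
  -- so Σ u ≤ γ Σ u forces u = 0.
  flux-nonneg : ∀ σ {y} → IsFluxVec M σ y → ∀ s → 0ℚ ≤ y s
  flux-nonneg σ {y} flux s = begin
    0ℚ         ≡⟨ +-inverseʳ (y s) ⟨
    y s - y s  ≤⟨ +-monoʳ-≤ (y s) (≤-trans (p≤q⊔p 0ℚ (- y s)) (u≤0 s)) ⟩
    y s + 0ℚ   ≡⟨ +-identityʳ (y s) ⟩
    y s        ∎
    where
    open ≤-Reasoning
    u : Fin n → ℚ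
    u s = 0ℚ ⊔ - y s
    0≤u : ∀ s → 0ℚ ≤ u s
    0≤u s = p≤p⊔q 0ℚ (- y s)
    0≤y+u : ∀ s → 0ℚ ≤ y s + u s
    0≤y+u s = ≤-trans (≤-reflexive (sym (+-inverseʳ (y s)))) (+-monoʳ-≤ (y s) (p≤q⊔p 0ℚ (- y s)))
    γ*inflow-u≡ : ∀ s → γ * inflow σ u s ≡ - y s + (1ℚ + γ * inflow σ (λ s′ → y s′ + u s′) s)
    γ*inflow-u≡ s = begin-equality
      γ * inflow σ u s
        ≡⟨ solve 3 (λ g p q → g :* q := :- (con 1ℚ :+ g :* p) :+ (con 1ℚ :+ g :* (p :+ q))) refl
                 γ (inflow σ y s) (inflow σ u s) ⟩
      - (1ℚ + γ * inflow σ y s) + (1ℚ + γ * (inflow σ y s + inflow σ u s))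
        ≡⟨ cong₂ (λ p q → - p + (1ℚ + γ * q)) (flux s) (inflow-+ σ y u s) ⟨
      - y s + (1ℚ + γ * inflow σ (λ s′ → y s′ + u s′) s) ∎
    u≤γ*inflow-u : ∀ s → u s ≤ γ * inflow σ u s
    u≤γ*inflow-u s = ⊔-lub (0≤p*q 0≤γ (inflow-nonneg σ 0≤u s))
      (≤-from-gap {p = - y s} (+-mono-≤ (nonNegative⁻¹ 1ℚ) (0≤p*q 0≤γ (inflow-nonneg σ 0≤y+u s)))
                  (γ*inflow-u≡ s))
    ∑u≤γ*∑u : ∑ n u ≤ γ * ∑ n u
    ∑u≤γ*∑u = begin
      ∑ n u                          ≤⟨ ∑-mono n u≤γ*inflow-u ⟩
      ∑ n (λ s → γ * inflow σ u s)   ≡⟨ *-distribˡ-∑ n γ _ ⟨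
      γ * ∑ n (inflow σ u)           ≡⟨ cong (γ *_) (∑-inflow σ u) ⟩
      γ * ∑ n u                      ∎
    u≤0 : ∀ s → u s ≤ 0ℚ
    u≤0 s = ≤-trans (term≤∑ 0≤u s) (≤-contraction⇒≤0 γ<1 ∑u≤γ*∑u)

  1≤flux : ∀ σ {y} → IsFluxVec M σ y → ∀ s → 1ℚ ≤ y s
  1≤flux σ {y} flux s = ≤-from-gap (0≤p*q 0≤γ (inflow-nonneg σ (flux-nonneg σ flux) s)) (flux s)

  rTx-by-state : ∀ σ y → rTx M σ y ≡ ∑ n (λ s → rew (act σ s) * y s)
  rTx-by-state σ y = begin
    ∑ m (λ a → rew a * flux M σ y a)
      ≡⟨ ∑-cong m (λ a → trans (*-if _ (rew a) _) (sym (∑-supported _ (src a) (off-source a)))) ⟩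
    ∑ m (λ a → ∑ n (λ s → if ⌊ act σ s ≟ a ⌋ then rew a * y s else 0ℚ))
      ≡⟨ ∑-comm m n _ ⟩
    ∑ n (λ s → ∑ m (λ a → if ⌊ act σ s ≟ a ⌋ then rew a * y s else 0ℚ))
      ≡⟨ ∑-cong n (λ s → ∑-select (act σ s) (λ a → rew a * y s)) ⟩
    ∑ n (λ s → rew (act σ s) * y s) ∎
    where
    open ≡-Reasoning
    off-source : ∀ a s → s ≢ src a → (if ⌊ act σ s ≟ a ⌋ then rew a * y s else 0ℚ) ≡ 0ℚ
    off-source a s s≢src with act σ s ≟ a
    ... | yes refl = contradiction (sym (ok σ s)) s≢src
    ... | no _     = refl

  gain-own-action : ∀ π {v} → IsValue M π v → ∀ s → gain M v (act π s) ≡ 0ℚ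
  gain-own-action π {v} value s = begin
    q - v (src a)  ≡⟨ cong (λ t → q - v t) (ok π s) ⟩
    q - v s        ≡⟨ cong (λ x → q - x) (value s) ⟩
    q - q          ≡⟨ +-inverseʳ q ⟩
    0ℚ             ∎
    where
    open ≡-Reasoning
    a = act π s
    q = rew a + γ * v (tgt a)

  rTx-via-gains : ∀ σ {y} (v : Fin n → ℚ) → IsFluxVec M σ y →
                  rTx M σ y ≡ ∑ n v + ∑ n (λ s → gain M v (act σ s) * y s)
  rTx-via-gains σ {y} v flux = begin
    R                          ≡⟨ solve 3 (λ r g q → r := (r :+ g :* q) :- g :* q) refl R γ Q ⟩
    (R + γ * Q) - γ * Q        ≡⟨ cong (_- γ * Q) balance ⟩
    (G + (V + γ * Q)) - γ * Q  ≡⟨ solve 4 (λ g x c q → (g :+ (x :+ c :* q)) :- c :* q := x :+ g)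
                                        refl G V γ Q ⟩
    V + G                      ∎
    where
    open ≡-Reasoning
    R = rTx M σ y
    V = ∑ n v
    G = ∑ n (λ s → gain M v (act σ s) * y s)
    Q = ∑ n (λ s → y s * v (next M σ s))
    pointwise : ∀ s → rew (act σ s) * y s + γ * (y s * v (next M σ s))
                      ≡ gain M v (act σ s) * y s + v s * y s
    pointwise s = trans
      (solve 5 (λ r g w x y → r :* y :+ g :* (y :* w) := (r :+ g :* w :- x) :* y :+ x :* y) refl
             (rew (act σ s)) γ (v (next M σ s)) (v s) (y s))
      (cong (λ t → (rew (act σ s) + γ * v (next M σ s) - v t) * y s + v s * y s) (sym (ok σ s)))
    balance : R + γ * Q ≡ G + (V + γ * Q)
    balance = begin
      R + γ * Q
        ≡⟨ cong₂ _+_ (rTx-by-state σ y) (*-distribˡ-∑ n γ _) ⟩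
      ∑ n (λ s → rew (act σ s) * y s) + ∑ n (λ s → γ * (y s * v (next M σ s)))
        ≡⟨ ∑-+ n _ _ ⟨
      ∑ n (λ s → rew (act σ s) * y s + γ * (y s * v (next M σ s)))
        ≡⟨ ∑-cong n pointwise ⟩
      ∑ n (λ s → gain M v (act σ s) * y s + v s * y s)
        ≡⟨ ∑-+ n _ _ ⟩
      G + ∑ n (λ s → v s * y s)
        ≡⟨ cong (G +_) (flux-balance σ flux v) ⟩
      G + (V + γ * Q) ∎

  rTx-of-value : ∀ π {v y} → IsValue M π v → IsFluxVec M π y → rTx M π y ≡ ∑ n v
  rTx-of-value π {v} {y} value flux = begin
    rTx M π y                                    ≡⟨ rTx-via-gains π v flux ⟩
    ∑ n v + ∑ n (λ s → gain M v (act π s) * y s) ≡⟨ cong (∑ n v +_) (∑-cong n no-gain) ⟩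
    ∑ n v + ∑ n (λ _ → 0ℚ)                       ≡⟨ cong (∑ n v +_) (∑-zero n) ⟩
    ∑ n v + 0ℚ                                   ≡⟨ +-identityʳ (∑ n v) ⟩
    ∑ n v                                        ∎
    where
    open ≡-Reasoning
    no-gain : ∀ s → gain M v (act π s) * y s ≡ 0ℚ
    no-gain s = trans (cong (_* y s) (gain-own-action π value s)) (*-zeroˡ (y s))

  rTx-after-switch : ∀ π π′ {v y′} a → IsValue M π v →
                     (∀ s → act π′ s ≡ (if ⌊ s ≟ src a ⌋ then a else act π s)) →
                     IsFluxVec M π′ y′ → rTx M π′ y′ ≡ ∑ n v + gain M v a * y′ (src a)
  rTx-after-switch π π′ {v} {y′} a value switch flux′ = begin
    rTx M π′ y′                                     ≡⟨ rTx-via-gains π′ v flux′ ⟩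
    ∑ n v + ∑ n (λ s → gain M v (act π′ s) * y′ s)  ≡⟨ cong (∑ n v +_) (∑-supported _ (src a) unchanged) ⟩
    ∑ n v + gain M v (act π′ (src a)) * y′ (src a)  ≡⟨ cong (λ b → ∑ n v + gain M v b * y′ (src a)) switched ⟩
    ∑ n v + gain M v a * y′ (src a)                 ∎
    where
    open ≡-Reasoning
    switched : act π′ (src a) ≡ a
    switched = trans (switch (src a)) (if-≟-refl (src a))
    unchanged : ∀ s → s ≢ src a → gain M v (act π′ s) * y′ s ≡ 0ℚ
    unchanged s s≢src = begin
      gain M v (act π′ s) * y′ s  ≡⟨ cong (λ b → gain M v b * y′ s) (trans (switch s) (if-≟-≢ s≢src)) ⟩
      gain M v (act π s) * y′ s   ≡⟨ cong (_* y′ s) (gain-own-action π value s) ⟩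
      0ℚ * y′ s                   ≡⟨ *-zeroˡ (y′ s) ⟩
      0ℚ                          ∎

  flux-potential-bound : ∀ σ {y} → IsFluxVec M σ y → (T H : Fin n → ℚ) → (∀ s → 0ℚ ≤ H s) →
                         (∀ s → H s ≡ T s + H (next M σ s)) → ∑ n (λ s → T s * y s) ≤ ∑ n H
  flux-potential-bound σ {y} flux T H 0≤H step = ≤-from-gap (0≤p*q (0≤p-q (<⇒≤ γ<1)) 0≤W) (begin
    ∑ n H                    ≡⟨ solve 3 (λ h g w → h := (h :+ g :* w) :- g :* w) refl (∑ n H) γ W ⟩
    (∑ n H + γ * W) - γ * W  ≡⟨ cong (_- γ * W) balance ⟨
    (B + W) - γ * W          ≡⟨ solve 3 (λ b g w → (b :+ w) :- g :* w := b :+ (con 1ℚ :- g) :* w)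
                                      refl B γ W ⟩
    B + (1ℚ - γ) * W         ∎)
    where
    open ≡-Reasoning
    B = ∑ n (λ s → T s * y s)
    W = ∑ n (λ s → y s * H (next M σ s))
    0≤W : 0ℚ ≤ W
    0≤W = ∑-nonneg n (λ s → 0≤p*q (flux-nonneg σ flux s) (0≤H _))
    telescope : ∀ s → T s * y s + y s * H (next M σ s) ≡ H s * y s
    telescope s = trans
      (solve 3 (λ t y h → t :* y :+ y :* h := (t :+ h) :* y) refl (T s) (y s) (H (next M σ s)))
      (cong (_* y s) (sym (step s)))
    balance : B + W ≡ ∑ n H + γ * W
    balance = begin
      B + W                                          ≡⟨ ∑-+ n _ _ ⟨
      ∑ n (λ s → T s * y s + y s * H (next M σ s))   ≡⟨ ∑-cong n telescope ⟩
      ∑ n (λ s → H s * y s)                          ≡⟨ flux-balance σ flux H ⟩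
      ∑ n H + γ * W                                  ∎

module FunctionalGraph {n m} (M : DMDP n m) where

  open import Data.Nat using (zero; suc; _+_; _∸_; _<_; _≤_; z<s)
  import Data.Nat.Properties as ℕP
  open import Data.Fin using (Fin; toℕ; _≟_)
  open import Data.Fin.Properties using (pigeonhole; toℕ<n)
  open import Data.Product using (∃; _×_; _,_)
  open import Relation.Binary.PropositionalEquality
  open import Relation.Nullary using (Dec)

  iter-+ : ∀ σ p q s → iter M σ (q + p) s ≡ iter M σ q (iter M σ p s)
  iter-+ σ p zero    s = refl
  iter-+ σ p (suc q) s = cong (next M σ) (iter-+ σ p q s)

  iter-next : ∀ σ k s → iter M σ k (next M σ s) ≡ next M σ (iter M σ k s)
  iter-next σ zero    s = refl
  iter-next σ (suc k) s = cong (next M σ) (iter-next σ k s)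

  -- OnCycle with the period bounded by n, which makes it decidable.
  Periodic : Policy M → Fin n → Set
  Periodic σ s = ∃ λ k → k < n × iter M σ (suc k) s ≡ s

  periodic? : ∀ σ s → Dec (Periodic σ s)
  periodic? σ s = ℕP.anyUpTo? (λ k → iter M σ (suc k) s ≟ s) n

  Periodic⇒OnCycle : ∀ {σ s} → Periodic σ s → OnCycle M σ s
  Periodic⇒OnCycle (k , _ , return) = suc k , z<s , return

  Periodic-next : ∀ σ {s} → Periodic σ s → Periodic σ (next M σ s)
  Periodic-next σ {s} (k , k<n , return) =
    k , k<n , trans (cong (next M σ) (iter-next σ k s)) (cong (next M σ) return)

  Periodic-iter : ∀ σ {s} i → Periodic σ s → Periodic σ (iter M σ i s)
  Periodic-iter σ zero    p = p
  Periodic-iter σ (suc i) p = Periodic-next σ (Periodic-iter σ i p)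

  Periodic-iter-n : ∀ σ s → Periodic σ (iter M σ n s)
  Periodic-iter-n σ s with pigeonhole ℕP.≤-refl (λ (i : Fin (suc n)) → iter M σ (toℕ i) s)
  ... | i , j , i<j , repeat = subst (Periodic σ) enter (Periodic-iter σ (n ∸ a) periodic)
    where
    a = toℕ i
    b = toℕ j
    k = b ∸ suc a
    b≡1+k+a : b ≡ suc k + a
    b≡1+k+a = trans (sym (ℕP.m∸n+n≡m i<j)) (ℕP.+-suc k a)
    b≤n : b ≤ n
    b≤n = ℕP.≤-pred (toℕ<n j)
    periodic : Periodic σ (iter M σ a s)
    periodic = k , ℕP.≤-trans (ℕP.m≤m+n (suc k) a) (subst (_≤ n) b≡1+k+a b≤n) ,
      trans (sym (iter-+ σ a (suc k) s)) (trans (cong (λ c → iter M σ c s) (sym b≡1+k+a)) (sym repeat))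
    enter : iter M σ (n ∸ a) (iter M σ a s) ≡ iter M σ n s
    enter = trans (sym (iter-+ σ a (n ∸ a) s))
                  (cong (λ c → iter M σ c s) (ℕP.m∸n+n≡m (ℕP.≤-trans (ℕP.<⇒≤ i<j) b≤n)))

module CycleActions {n m} (M : DMDP n m) where

  open import Data.Nat using (ℕ; suc; _+_; _<_; _≤_; _≤′_; ≤′-refl; ≤′-step)
  import Data.Nat.Properties as ℕP
  open import Data.Fin using (_≟_)
  open import Data.Product using (_,_)
  open import Function.Bundles using (Equivalence)
  open import Relation.Binary.PropositionalEquality
  open import Relation.Nullary using (¬_)
  open import Relation.Nullary.Decidable using (decidable-stable)
  open FunctionalGraph M using (iter-+)

  OnCycle-iter : ∀ σ {s} i → OnCycle M σ s → OnCycle M σ (iter M σ i s)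
  OnCycle-iter σ {s} i (k , 0<k , return) = k , 0<k , (begin
    iter M σ k (iter M σ i s)  ≡⟨ iter-+ σ i k s ⟨
    iter M σ (k + i) s         ≡⟨ cong (λ c → iter M σ c s) (ℕP.+-comm k i) ⟩
    iter M σ (i + k) s         ≡⟨ iter-+ σ k i s ⟩
    iter M σ i (iter M σ k s)  ≡⟨ cong (iter M σ i) return ⟩
    iter M σ i s               ∎)
    where open ≡-Reasoning

  CycleActionsFrom : Policy M → Policy M → Set
  CycleActionsFrom π σ = ∀ s → OnCycle M σ s → act σ s ≡ act π s

  noNewCycle⇒CycleActionsFrom : ∀ {π} σ σ′ → ¬ CreatesNewCycle M σ σ′ →
                                CycleActionsFrom π σ → CycleActionsFrom π σ′
  noNewCycle⇒CycleActionsFrom {π} σ σ′ noNew old s onCycle =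
    decidable-stable (act σ′ s ≟ act π s) λ new → noNew (s , onCycle , λ (s₀ , onCycle₀ , same) →
      new (old-action (Equivalence.to (same (act σ′ s)) (0 , refl)) onCycle₀))
    where
    old-action : ∀ {s₀} → CycleAct M σ s₀ (act σ′ s) → OnCycle M σ s₀ → act σ′ s ≡ act π s
    old-action {s₀} (i , σ′s≡σt) onCycle₀ =
      trans σ′s≡σt (trans (old t (OnCycle-iter σ i onCycle₀)) (cong (act π) t≡s))
      where
      t = iter M σ i s₀
      t≡s : t ≡ s
      t≡s = trans (sym (ok σ t)) (trans (cong (DMDP.src M) (sym σ′s≡σt)) (ok σ′ s))

  CycleActionsFrom-run : ∀ (p : ℕ → Policy M) {i k} → i ≤′ k →
                         (∀ l → i ≤ l → l < k → ¬ CreatesNewCycle M (p l) (p (suc l))) →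
                         CycleActionsFrom (p i) (p k)
  CycleActionsFrom-run p ≤′-refl noNew = λ s _ → refl
  CycleActionsFrom-run p {i} {suc k} (≤′-step i≤′k) noNew =
    noNewCycle⇒CycleActionsFrom {p i} (p k) (p (suc k)) (noNew k (ℕP.≤′⇒≤ i≤′k) ℕP.≤-refl)
      (CycleActionsFrom-run p i≤′k (λ l i≤l l<k → noNew l i≤l (ℕP.m≤n⇒m≤1+n l<k)))

module OffCycleFlux {n m} (M : DMDP n m) where

  open import Data.Nat as ℕ using (suc)
  open import Data.Fin using (Fin; toℕ)
  open import Data.Bool using (true; false; if_then_else_)
  open import Data.Rational using (ℚ; 0ℚ; 1ℚ; _+_; _*_; _≤_; nonNegative)
  open import Data.Rational.Properties
    using (≤-refl; ≤-reflexive; ≤-trans; +-identityʳ; *-identityˡ; *-zeroˡ; *-zeroʳ;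
           nonNegative⁻¹; *-monoʳ-≤-nonNeg; *-monoˡ-≤-nonNeg; module ≤-Reasoning; +-*-ring)
  open import Algebra.Bundles using (Ring)
  open import Algebra.Properties.Semiring.Mult (Ring.semiring +-*-ring) using (×-assocˡ)
  open import Relation.Binary.PropositionalEquality
  open import Relation.Nullary using (¬_; Dec; yes; no; does)
  open import Relation.Nullary.Decidable using (dec-true; dec-false)
  open FiniteSum
  open RationalArithmetic using (_·_)
  open FunctionalGraph M
  open Flux M using (flux-nonneg; flux-potential-bound; gain-own-action)
  open CycleActions M using (CycleActionsFrom)

  offCycle : Policy M → Fin n → ℚ
  offCycle σ s = if does (periodic? σ s) then 0ℚ else 1ℚ

  offCycle-periodic : ∀ σ {s} → Periodic σ s → offCycle σ s ≡ 0ℚ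
  offCycle-periodic σ {s} p = cong (if_then 0ℚ else 1ℚ) (dec-true (periodic? σ s) p)

  offCycle-aperiodic : ∀ σ {s} → ¬ Periodic σ s → offCycle σ s ≡ 1ℚ
  offCycle-aperiodic σ {s} ¬p = cong (if_then 0ℚ else 1ℚ) (dec-false (periodic? σ s) ¬p)

  0≤offCycle : ∀ σ s → 0ℚ ≤ offCycle σ s
  0≤offCycle σ s with does (periodic? σ s)
  ... | true  = ≤-refl
  ... | false = nonNegative⁻¹ 1ℚ

  offCycle≤1 : ∀ σ s → offCycle σ s ≤ 1ℚ
  offCycle≤1 σ s with does (periodic? σ s)
  ... | true  = nonNegative⁻¹ 1ℚ
  ... | false = ≤-refl

  -- The distance from s to the cycle it runs into, counted among its first n iterates.
  height : Policy M → Fin n → ℚ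
  height σ s = ∑ n (λ k → offCycle σ (iter M σ (toℕ k) s))

  height-step : ∀ σ s → height σ s ≡ offCycle σ s + height σ (next M σ s)
  height-step σ s = begin
    height σ s                               ≡⟨ +-identityʳ (height σ s) ⟨
    height σ s + 0ℚ                          ≡⟨ cong (height σ s +_) reaches-cycle ⟨
    height σ s + offCycle σ (iter M σ n s)   ≡⟨ ∑-shift n (λ k → offCycle σ (iter M σ k s)) ⟩
    offCycle σ s + ∑ n (λ k → offCycle σ (iter M σ (suc (toℕ k)) s))
      ≡⟨ cong (offCycle σ s +_) (∑-cong n (λ k → cong (offCycle σ) (iter-next σ (toℕ k) s))) ⟨
    offCycle σ s + height σ (next M σ s)     ∎
    where
    open ≡-Reasoning
    reaches-cycle : offCycle σ (iter M σ n s) ≡ 0ℚ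
    reaches-cycle = offCycle-periodic σ (Periodic-iter-n σ s)

  0≤height : ∀ σ s → 0ℚ ≤ height σ s
  0≤height σ s = ∑-nonneg n (λ k → 0≤offCycle σ _)

  height≤n : ∀ σ s → height σ s ≤ n · 1ℚ
  height≤n σ s = ≤-trans (∑-mono n (λ k → offCycle≤1 σ _)) (≤-reflexive (∑-const n 1ℚ))

  ∑-offCycle-flux≤n² : ∀ σ {y} → IsFluxVec M σ y →
                       ∑ n (λ s → offCycle σ s * y s) ≤ (n ℕ.* n) · 1ℚ
  ∑-offCycle-flux≤n² σ {y} flux = begin
    ∑ n (λ s → offCycle σ s * y s)
      ≤⟨ flux-potential-bound σ flux (offCycle σ) (height σ) (0≤height σ) (height-step σ) ⟩
    ∑ n (height σ)         ≤⟨ ∑-mono n (height≤n σ) ⟩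
    ∑ n (λ _ → n · 1ℚ)     ≡⟨ ∑-const n (n · 1ℚ) ⟩
    n · (n · 1ℚ)           ≡⟨ ×-assocˡ 1ℚ n n ⟩
    (n ℕ.* n) · 1ℚ         ∎
    where open ≤-Reasoning

  ∑-gain-flux≤n² : ∀ π σ {v y Δ} → IsValue M π v → CycleActionsFrom π σ → 0ℚ ≤ Δ →
                   (∀ b → gain M v b ≤ Δ) → IsFluxVec M σ y →
                   ∑ n (λ s → gain M v (act σ s) * y s) ≤ Δ * ((n ℕ.* n) · 1ℚ)
  ∑-gain-flux≤n² π σ {v} {y} {Δ} value cycles 0≤Δ Δ-max flux = begin
    ∑ n (λ s → gain M v (act σ s) * y s)  ≤⟨ ∑-mono n (λ s → on-cycle-or-not s (periodic? σ s)) ⟩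
    ∑ n (λ s → Δ * (offCycle σ s * y s))  ≡⟨ *-distribˡ-∑ n Δ _ ⟨
    Δ * ∑ n (λ s → offCycle σ s * y s)    ≤⟨ *-monoˡ-≤-nonNeg Δ {{nonNegative 0≤Δ}}
                                                (∑-offCycle-flux≤n² σ flux) ⟩
    Δ * ((n ℕ.* n) · 1ℚ)                  ∎
    where
    open ≤-Reasoning
    on-cycle-or-not : ∀ s → Dec (Periodic σ s) → gain M v (act σ s) * y s ≤ Δ * (offCycle σ s * y s)
    on-cycle-or-not s (yes periodic) = ≤-reflexive (begin-equality
      gain M v (act σ s) * y s  ≡⟨ cong (λ b → gain M v b * y s) (cycles s (Periodic⇒OnCycle periodic)) ⟩
      gain M v (act π s) * y s  ≡⟨ cong (_* y s) (gain-own-action π value s) ⟩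
      0ℚ * y s                  ≡⟨ *-zeroˡ (y s) ⟩
      0ℚ                        ≡⟨ *-zeroʳ Δ ⟨
      Δ * 0ℚ                    ≡⟨ cong (Δ *_) (*-zeroˡ (y s)) ⟨
      Δ * (0ℚ * y s)            ≡⟨ cong (λ o → Δ * (o * y s)) (offCycle-periodic σ periodic) ⟨
      Δ * (offCycle σ s * y s)  ∎)
    on-cycle-or-not s (no aperiodic) = begin
      gain M v (act σ s) * y s  ≤⟨ *-monoʳ-≤-nonNeg (y s) {{nonNegative (flux-nonneg σ flux s)}}
                                                      (Δ-max (act σ s)) ⟩
      Δ * y s                   ≡⟨ cong (Δ *_) (*-identityˡ (y s)) ⟨
      Δ * (1ℚ * y s)            ≡⟨ cong (λ o → Δ * (o * y s)) (offCycle-aperiodic σ aperiodic) ⟨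
      Δ * (offCycle σ s * y s)  ∎

module Pivot {n m} (M : DMDP n m) where

  open import Data.Nat as ℕ using ()
  open import Data.Nat.Properties using (m*n≢0)
  open import Data.Integer using () renaming (+_ to ℤ+)
  open import Data.Product using (_,_)
  open import Data.Rational using (1ℚ; _+_; _*_; _-_; _≤_; _/_; nonNegative)
  open import Data.Rational.Properties
    using (≤-reflexive; ≤-trans; <⇒≤; *-identityʳ; *-monoˡ-≤-nonNeg; module ≤-Reasoning)
  open import Data.Rational.Solver using (module +-*-Solver)
  open import Relation.Binary.PropositionalEquality
  open DMDP M
  open RationalArithmetic
  open Flux M using (1≤flux; rTx-via-gains; rTx-of-value; rTx-after-switch)
  open CycleActions M using (CycleActionsFrom)
  open OffCycleFlux M using (∑-gain-flux≤n²)
  open +-*-Solver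

  pivot-bound : ∀ .{{_ : ℕ.NonZero n}} π π′ σ {y y′ y″} → HGPivot M π π′ → CycleActionsFrom π σ →
                IsFluxVec M π y → IsFluxVec M π′ y′ → IsFluxVec M σ y″ →
                rTx M σ y″ - rTx M π′ y′ ≤ factor n * (rTx M σ y″ - rTx M π y)
  pivot-bound π π′ σ {y} {y′} {y″} (v , value , a , 0<Δ , Δ-max , switch) cycles flux flux′ flux″ =
    gap-contraction {c} {rTx M π y} {rTx M π′ y′} {rTx M σ y″} (begin
      c * (rTx M σ y″ - rTx M π y)       ≡⟨ cong₂ (λ p q → c * (p - q)) (rTx-via-gains σ v flux″) value-π ⟩
      c * ((∑ n v + S) - ∑ n v)          ≡⟨ cong (c *_) (solve 2 (λ x s → (x :+ s) :- x := s) refl (∑ n v) S) ⟩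
      c * S                              ≤⟨ *-monoˡ-≤-nonNeg c {{nonNegative (0≤1/k (n ℕ.* n))}} S≤Δn² ⟩
      c * (Δ * n²)                       ≡⟨ solve 3 (λ c d k → c :* (d :* k) := d :* (c :* k)) refl c Δ n² ⟩
      Δ * (c * n²)                       ≡⟨ cong (Δ *_) (1/k*k·1ℚ≡1 (n ℕ.* n)) ⟩
      Δ * 1ℚ                             ≡⟨ *-identityʳ Δ ⟩
      Δ                                  ≤⟨ Δ≤Δ*y′ ⟩
      Δ * y′ (src a)                     ≡⟨ solve 2 (λ x d → d := (x :+ d) :- x) refl (∑ n v) (Δ * y′ (src a)) ⟩
      (∑ n v + Δ * y′ (src a)) - ∑ n v   ≡⟨ cong₂ _-_ (rTx-after-switch π π′ a value switch flux′) value-π ⟨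
      rTx M π′ y′ - rTx M π y            ∎)
    where
    open ≤-Reasoning
    instance _ = m*n≢0 n n
    c = ℤ+ 1 / (n ℕ.* n)
    n² = (n ℕ.* n) · 1ℚ
    Δ = gain M v a
    S = ∑ n (λ s → gain M v (act σ s) * y″ s)
    value-π : rTx M π y ≡ ∑ n v
    value-π = rTx-of-value π value flux
    S≤Δn² : S ≤ Δ * n²
    S≤Δn² = ∑-gain-flux≤n² π σ value cycles (<⇒≤ 0<Δ) Δ-max flux″
    Δ≤Δ*y′ : Δ ≤ Δ * y′ (src a)
    Δ≤Δ*y′ = ≤-trans (≤-reflexive (sym (*-identityʳ Δ)))
                     (*-monoˡ-≤-nonNeg Δ {{nonNegative (<⇒≤ 0<Δ)}} (1≤flux π′ flux′ (src a)))

open import Data.Nat using (ℕ; suc; NonZero; _<_; _≤_)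
open import Data.Fin using (Fin)
open import Data.Rational using (ℚ; _*_; _-_) renaming (_≤_ to _≤ℚ_)
open import Data.Sum using (_⊎_)
open import Relation.Nullary using (¬_)
open import Relation.Binary.PropositionalEquality using (_≡_)
open import Data.Nat.Properties using (<⇒≤; ≤⇒≤′)

lemma3p2 : ∀ {n m} .{{_ : NonZero n}} (M : DMDP n m) (R : Run M) (i j : ℕ)
    → i < len R
    → ¬ CreatesNewCycle M (pol R i) (pol R (suc i))
    → i < j → j ≤ len R
    → (∀ k → i ≤ k → k < j → ¬ CreatesNewCycle M (pol R k) (pol R (suc k)))
    → (j ≡ len R ⊎ CreatesNewCycle M (pol R j) (pol R (suc j)))
    → (y y′ y″ : Fin n → ℚ)
    → IsFluxVec M (pol R i) y
    → IsFluxVec M (pol R (suc i)) y′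
    → IsFluxVec M (pol R j) y″
    → (rTx M (pol R j) y″ - rTx M (pol R (suc i)) y′)
        ≤ℚ factor n * (rTx M (pol R j) y″ - rTx M (pol R i) y)
lemma3p2 M R i j i<len _ i<j _ noNewCycle _ y y′ y″ flux flux′ flux″ =
  Pivot.pivot-bound M (pol R i) (pol R (suc i)) (pol R j) (step R i i<len)
    (CycleActions.CycleActionsFrom-run M (pol R) (≤⇒≤′ (<⇒≤ i<j)) noNewCycle)
    flux flux′ flux″
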